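{- Suppose every demand instance is narrow, i.e. has height at most $1/2$. Consider any algorithm following the modified two-phase framework that satisfies the interference property and is governed by parameters $\Delta$ and $\lambda$. Then the feasible solution $S$ produced satisfies $p(S)\geq \frac{\lambda}{1+2\Delta^2}\, p(\mathrm{Opt})$.
   Context: Setting (tree-networks with heights): $\mathcal{T}$ is a set of trees on vertex set $V$, and every edge offers bandwidth $1$. Each demand $a$ is a vertex pair with profit $p(a)$ and height $h(a)\in(0,1]$. $\mathcal{D}$ is the set of demand instances, where instance $d$ is a copy of demand $a_d$ on some accessible tree, with the same profit $p(d)$ and height $h(d)$, and path $\mathrm{path}(d)$. Two instances overlap if they are on the same tree and their paths share an edge, and they conflict if they overlap or belong to the same demand. A feasible solution is a set $S\subseteq\mathcal{D}$ containing at most one instance per demand such that for every edge $e$ the total height of instances of $S$ whose path contains $e$ is at most $1$. $\mathrm{Opt}$ is an optimal feasible solution. $\mathcal{E}$ is the set of all edges. Dual: variables $\alpha(a)\ge0$ and $\beta(e)\ge0$, with the constraint for $d$ being $\alpha(a_d)+h(d)\sum_{e\in\mathrm{path}(d)}\beta(e)\ge p(d)$. Modified two-phase framework. In the first phase, duals start at $0$. Each iteration picks a set $I$ of pairwise non-conflicting instances with unsatisfied constraints. For each $d\in I$, it computes $s=p(d)-\alpha(a_d)-h(d)\sum_{e\in\mathrm{path}(d)}\beta(e)$, chooses a set $\pi(d)$ of edges of $\mathrm{path}(d)$ (critical edges), and sets $\delta(d)=s/(1+2h(d)|\pi(d)|^2)$. It increases $\alpha(a_d)$ by $\delta(d)$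 and each $\beta(e)$, $e\in\pi(d)$, by $2|\pi(d)|\delta(d)$ ("$d$ is raised"), and then pushes $I$ onto a stack. In the second phase, sets are popped in reverse order, and each $d$ of a popped set is added to $S$ (initially empty) if $S\cup\{d\}$ is feasible. Interference property: whenever two overlapping raised instances $d_1,d_2$ have $d_1$ raised before $d_2$, $\mathrm{path}(d_2)$ contains an edge of $\pi(d_1)$. $\Delta=\max|\pi(d)|$ over raised $d$. An instance is $\xi$-satisfied if the left side of its dual constraint is at least $\xi p(d)$, and $\lambda\in[0,1]$ is the largest value such that all instances are $\lambda$-satisfied at the end of the first phase.
   Formalization: The profits $p(a)$ and heights $h(a)$ are rational, so the dual variables, the values δ(d) and λ are rational as well. -}

module Defs where

open import Data.Nat as ℕ using (ℕ; zero; suc; _⊔_)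
open import Data.Integer using (+_)
open import Data.Bool using (if_then_else_)
open import Data.Fin using (Fin)
open import Data.Fin.Properties using () renaming (_≟_ to _≟ᶠ_; all? to allFin?)
open import Data.Rational using (ℚ; 0ℚ; 1ℚ; ½; _+_; _*_; _-_; _≤_; _<_; _/_)
open import Data.Rational.Properties using (_≤?_)
open import Data.List using (List; []; _∷_; [_]; _++_; map; foldr; foldl; filter; length; concat; reverse)
open import Data.List.Membership.Propositional using (_∈_)
import Data.List.Membership.DecPropositional as DecMem
open import Data.List.Relation.Binary.Subset.Propositional using (_⊆_)
open import Data.List.Relation.Unary.All using (All)
open import Data.List.Relation.Unary.AllPairs using (AllPairs; allPairs?)
open import Data.List.Relation.Unary.Unique.Propositional using (Unique)
open import Data.Product using (Σ; ∃; _×_; _,_; proj₁; proj₂)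
open import Data.Sum using (_⊎_)
open import Data.Unit using (⊤)
open import Function using (_∘_)
open import Relation.Binary.PropositionalEquality using (_≡_; _≢_)
open import Relation.Nullary using (¬_; Dec; does; yes; no)
open import Relation.Nullary.Decidable using (_×-dec_; ¬?)

_∈ᶠ?_ : ∀ {k} (x : Fin k) (xs : List (Fin k)) → Dec (x ∈ xs)
x ∈ᶠ? xs = DecMem._∈?_ _≟ᶠ_ x xs

ℕ→ℚ : ℕ → ℚ
ℕ→ℚ k = + k / 1

sumℚ : List ℚ → ℚ
sumℚ = foldr _+_ 0ℚ

-- Edges of all trees together: Fin E,
-- each edge belongs to exactly one tree (owner) and has two endpoints.
-- Every edge has bandwidth 1.
record Network : Set where
  field
    n         : ℕ
    m         : ℕ
    E         : ℕ
    owner     : Fin E → Fin m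
    ends      : Fin E → Fin n × Fin n
    A         : ℕ
    endpoints : Fin A → Fin n × Fin n
    profit    : Fin A → ℚ
    height    : Fin A → ℚ
    K         : ℕ
    dem       : Fin K → Fin A
    tree      : Fin K → Fin m
    path      : Fin K → List (Fin E)

record Raise (K E : ℕ) : Set where
  constructor raise
  field
    inst : Fin K
    crit : List (Fin E)
    δ    : ℚ

record Duals (A E : ℕ) : Set where
  constructor duals
  field
    α : Fin A → ℚ
    β : Fin E → ℚ

module _ (N : Network) where
  open Network N

  data Walk (t : Fin m) : Fin n → Fin n → List (Fin E) → Set where
    []   : ∀ {u} → Walk t u u []
    step : ∀ {u w v e es} → owner e ≡ t →
           (ends e ≡ (u , w) ⊎ ends e ≡ (w , u)) →
           Walk t w v es → Walk t u v (e ∷ es)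

  Trail : Fin m → Fin n → Fin n → List (Fin E) → Set
  Trail t u v es = Walk t u v es × Unique es

  IsTree : Fin m → Set
  IsTree t = (∀ u v → ∃ λ es → Walk t u v es)
           × (∀ u es → Trail t u u es → es ≡ [])

  -- path(d) is the path in tree(d) between the endpoints of a_d
  -- (in a tree, a trail is the unique simple path)
  ValidPath : Fin K → Set
  ValidPath d = Trail (tree d) (proj₁ (endpoints (dem d))) (proj₂ (endpoints (dem d))) (path d)

  p : Fin K → ℚ
  p d = profit (dem d)

  h : Fin K → ℚ
  h d = height (dem d)

  Overlap : Fin K → Fin K → Set
  Overlap d d' = tree d ≡ tree d' × ∃ λ e → e ∈ path d × e ∈ path d'

  Conflict : Fin K → Fin K → Set
  Conflict d d' = Overlap d d' ⊎ dem d ≡ dem d'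

  load : List (Fin K) → Fin E → ℚ
  load S e = sumℚ (map h (filter (λ d → e ∈ᶠ? path d) S))

  Feasible : List (Fin K) → Set
  Feasible S = AllPairs (λ d d' → dem d ≢ dem d') S × (∀ e → load S e ≤ 1ℚ)

  feasible? : (S : List (Fin K)) → Dec (Feasible S)
  feasible? S = allPairs? (λ d d' → ¬? (dem d ≟ᶠ dem d')) S ×-dec allFin? (λ e → load S e ≤? 1ℚ)

  profitSum : List (Fin K) → ℚ
  profitSum S = sumℚ (map p S)

  -- left-hand side of the dual constraint of d
  lhs : Duals A E → Fin K → ℚ
  lhs D d = Duals.α D (dem d) + h d * sumℚ (map (Duals.β D) (path d))

  Satisfied : Duals A E → ℚ → Fin K → Set
  Satisfied D ξ d = ξ * p d ≤ lhs D d

  zeroDuals : Duals A E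
  zeroDuals = duals (λ _ → 0ℚ) (λ _ → 0ℚ)

  incα : Raise K E → Fin A → ℚ
  incα r a = if does (a ≟ᶠ dem (Raise.inst r)) then Raise.δ r else 0ℚ

  incβ : Raise K E → Fin E → ℚ
  incβ r e = if does (e ∈ᶠ? Raise.crit r)
               then ℕ→ℚ (2 ℕ.* length (Raise.crit r)) * Raise.δ r
               else 0ℚ

  iterate : Duals A E → List (Raise K E) → Duals A E
  iterate D I = duals (λ a → Duals.α D a + sumℚ (map (λ r → incα r a) I))
                      (λ e → Duals.β D e + sumℚ (map (λ r → incβ r e) I))

  -- duals at the end of the first phase (run = list of iterations, first first)
  phase1 : List (List (Raise K E)) → Duals A E
  phase1 = foldl iterate zeroDuals

  ValidRaise : Duals A E → Raise K E → Set
  ValidRaise D r =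
    let d = Raise.inst r
        π = Raise.crit r
        s = p d - lhs D d
    in (0ℚ < s)
     × (π ⊆ path d) × Unique π
     × (Raise.δ r * (1ℚ + ℕ→ℚ 2 * h d * ℕ→ℚ (length π ℕ.* length π)) ≡ s)

  ValidIter : Duals A E → List (Raise K E) → Set
  ValidIter D I = AllPairs (λ r r' → ¬ Conflict (Raise.inst r) (Raise.inst r')) I
                × All (ValidRaise D) I

  ValidRun : Duals A E → List (List (Raise K E)) → Set
  ValidRun D []        = ⊤
  ValidRun D (I ∷ run) = ValidIter D I × ValidRun (iterate D I) run

  Interference : List (List (Raise K E)) → Set
  Interference []        = ⊤
  Interference (I ∷ run) =
    (∀ {r₁} → r₁ ∈ I → ∀ {J} → J ∈ run → ∀ {r₂} → r₂ ∈ J →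
       Overlap (Raise.inst r₁) (Raise.inst r₂) →
       ∃ λ e → e ∈ Raise.crit r₁ × e ∈ path (Raise.inst r₂))
    × Interference run

  tryAdd : List (Fin K) → Fin K → List (Fin K)
  tryAdd S d = if does (feasible? (S ++ [ d ])) then S ++ [ d ] else S

  popSet : List (Fin K) → List (Raise K E) → List (Fin K)
  popSet S I = foldl tryAdd S (map Raise.inst I)

  phase2 : List (List (Raise K E)) → List (Fin K)
  phase2 run = foldl popSet [] (reverse run)

  Δ : List (List (Raise K E)) → ℕ
  Δ run = foldr _⊔_ 0 (map (length ∘ Raise.crit) (concat run))

  IsLambda : List (List (Raise K E)) → ℚ → Set
  IsLambda run λ′ =
    (0ℚ ≤ λ′) × (λ′ ≤ 1ℚ) × (∀ d → Satisfied (phase1 run) λ′ d)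
    × (∀ μ → 0ℚ ≤ μ → μ ≤ 1ℚ → (∀ d → Satisfied (phase1 run) μ d) → μ ≤ λ′)

  IsOpt : List (Fin K) → Set
  IsOpt O = Feasible O × (∀ F → Feasible F → profitSum F ≤ profitSum O)

module Submission where

-- A raise of δ(d) increases the left-hand sides of the dual constraints of a feasible set O by at
-- most (1 + 2|π(d)|²)·δ(d) in total: the α-part reaches at most one instance of O per demand, and the
-- β-part is 2|π(d)|·δ(d) times the load of O on the |π(d)| critical edges, each load being at most 1.
-- With λ-satisfaction this gives λ·p(Opt) ≤ (1 + 2Δ²)·Σδ.
--
-- Conversely Σδ ≤ p(S), by unwinding the stack. A popped instance d that is added pays δ(d) out of
-- its slack p(d) − lhs(d). If d is blocked, either an instance of S shares its demand and gained δ(d)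
-- through α, or some edge of path(d) already carries load above 1 − h(d) ≥ ½. Instances popped with d
-- do not conflict with it, so this load comes from instances raised after d; by interference each of
-- them uses a critical edge of d and gained at least 2δ(d)·h through β, so together at least δ(d).

open import Defs
open import Data.Fin using (Fin)
open import Data.List using (List)
open import Data.Rational using (ℚ; 0ℚ; 1ℚ; ½; _+_; _*_; _≤_; _<_)

open import Algebra.Bundles using (CommutativeMonoid)
open import Data.Empty using (⊥-elim)
open import Data.Bool using (Bool; true; false; if_then_else_)
import Data.Fin.Properties as Fin
import Data.Integer as ℤ
import Data.Integer.Properties as ℤ
open import Data.List using ([]; _∷_; [_]; _++_; map; foldr; foldl; concat; reverse; length)
import Data.List.Properties as List
open import Data.List.Membership.Propositional using (_∈_; _∉_; find)
import Data.List.Membership.Propositional.Properties as ∈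
open import Data.List.Relation.Binary.Subset.Propositional using (_⊆_)
open import Data.List.Relation.Unary.All as All using (All; []; _∷_)
import Data.List.Relation.Unary.All.Properties as All
open import Data.List.Relation.Unary.AllPairs using (AllPairs; []; _∷_)
import Data.List.Relation.Unary.AllPairs.Properties as AllPairs
open import Data.List.Relation.Unary.Any using (here; there; any?)
open import Data.List.Relation.Unary.Unique.Propositional using (Unique)
open import Data.Nat as ℕ using (ℕ; _⊔_)
import Data.Nat.Properties as ℕ
open import Data.Product using (∃; _×_; _,_; proj₁; proj₂)
open import Data.Rational using (_-_; -_; toℚᵘ; positive; nonNegative)
open import Data.Rational.Properties
open import Data.Rational.Solver using (module +-*-Solver)
import Data.Rational.Unnormalised as ℚᵘ
import Data.Rational.Unnormalised.Properties as ℚᵘ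
open import Data.Sum using (_⊎_; inj₁; inj₂)
open import Relation.Binary.PropositionalEquality hiding ([_])
open import Relation.Nullary using (¬_; Dec; does; yes; no; contradiction)

open +-*-Solver
open import Algebra.Properties.CommutativeSemigroup
  (CommutativeMonoid.commutativeSemigroup +-0-commutativeMonoid)
  using () renaming (interchange to +-interchange; x∙yz≈y∙xz to +-left-comm)

0≤1 : 0ℚ ≤ 1ℚ
0≤1 = nonNegative⁻¹ 1ℚ

+-nonNeg : ∀ {p q} → 0ℚ ≤ p → 0ℚ ≤ q → 0ℚ ≤ p + q
+-nonNeg = +-mono-≤

*-nonNeg : ∀ {p q} → 0ℚ ≤ p → 0ℚ ≤ q → 0ℚ ≤ p * q
*-nonNeg {p} {q} 0≤p 0≤q =
  nonNegative⁻¹ (p * q) {{nonNeg*nonNeg⇒nonNeg p {{nonNegative 0≤p}} q {{nonNegative 0≤q}}}}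

*-monoˡ-≤-0≤ : ∀ {r p q} → 0ℚ ≤ r → p ≤ q → r * p ≤ r * q
*-monoˡ-≤-0≤ {r} 0≤r = *-monoˡ-≤-nonNeg r {{nonNegative 0≤r}}

*-monoʳ-≤-0≤ : ∀ {r p q} → 0ℚ ≤ r → p ≤ q → p * r ≤ q * r
*-monoʳ-≤-0≤ {r} 0≤r = *-monoʳ-≤-nonNeg r {{nonNegative 0≤r}}

+-cancelʳ-≤ : ∀ {p q} r → p + r ≤ q + r → p ≤ q
+-cancelʳ-≤ {p} {q} r p+r≤q+r = subst₂ _≤_ (cancel p) (cancel q) (+-monoˡ-≤ (- r) p+r≤q+r)
  where
  cancel : ∀ x → x + r - r ≡ x
  cancel x = solve 2 (λ x r → x :+ r :- r := x) refl x r

+-transfer-≤ : ∀ {p q} a b i t w → a + w + t ≤ p → b + i ≤ q + w → (a + b) + (i + t) ≤ p + q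
+-transfer-≤ {p} {q} a b i t w global local = +-cancelʳ-≤ w
  (subst₂ _≤_ (solve 5 (λ a b i t w → a :+ w :+ t :+ (b :+ i) := a :+ b :+ (i :+ t) :+ w) refl a b i t w)
              (solve 3 (λ p q w → p :+ (q :+ w) := p :+ q :+ w) refl p q w)
              (+-mono-≤ global local))

½≤-of-1<+ : ∀ {a b} → 1ℚ < a + b → b ≤ ½ → ½ ≤ a
½≤-of-1<+ {a} 1<a+b b≤½ = +-cancelʳ-≤ ½ (<⇒≤ (<-≤-trans 1<a+b (+-monoʳ-≤ a b≤½)))

if-nonNeg : ∀ {k} → 0ℚ ≤ k → (b : Bool) → 0ℚ ≤ (if b then k else 0ℚ)
if-nonNeg 0≤k true  = 0≤k
if-nonNeg 0≤k false = ≤-refl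

if-does-yes : ∀ {A B : Set} (a? : Dec A) {x y : B} → A → (if does a? then x else y) ≡ x
if-does-yes (yes _) a = refl
if-does-yes (no ¬a) a = contradiction a ¬a

if-does-no : ∀ {A B : Set} (a? : Dec A) {x y : B} → ¬ A → (if does a? then x else y) ≡ y
if-does-no (yes a) ¬a = contradiction a ¬a
if-does-no (no _)  ¬a = refl

ℕ→ℚᵘ-≃ : ∀ n → toℚᵘ (ℕ→ℚ n) ℚᵘ.≃ ℚᵘ.mkℚᵘ (ℤ.+ n) 0
ℕ→ℚᵘ-≃ n = toℚᵘ-fromℚᵘ (ℚᵘ.mkℚᵘ (ℤ.+ n) 0)

ℕ→ℚ-homo-+ : ∀ m n → ℕ→ℚ (m ℕ.+ n) ≡ ℕ→ℚ m + ℕ→ℚ n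
ℕ→ℚ-homo-+ m n = toℚᵘ-injective (begin
  toℚᵘ (ℕ→ℚ (m ℕ.+ n))                  ≈⟨ ℕ→ℚᵘ-≃ (m ℕ.+ n) ⟩
  ℚᵘ.mkℚᵘ (ℤ.+ (m ℕ.+ n)) 0               ≈⟨ integral-sum ⟩
  ℚᵘ.mkℚᵘ (ℤ.+ m) 0 ℚᵘ.+ ℚᵘ.mkℚᵘ (ℤ.+ n) 0  ≈⟨ ℚᵘ.+-cong (ℚᵘ.≃-sym (ℕ→ℚᵘ-≃ m)) (ℚᵘ.≃-sym (ℕ→ℚᵘ-≃ n)) ⟩
  toℚᵘ (ℕ→ℚ m) ℚᵘ.+ toℚᵘ (ℕ→ℚ n)        ≈⟨ ℚᵘ.≃-sym (toℚᵘ-homo-+ (ℕ→ℚ m) (ℕ→ℚ n)) ⟩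
  toℚᵘ (ℕ→ℚ m + ℕ→ℚ n)                  ∎)
  where
  open import Relation.Binary.Reasoning.Setoid ℚᵘ.≃-setoid
  integral-sum : ℚᵘ.mkℚᵘ (ℤ.+ (m ℕ.+ n)) 0 ℚᵘ.≃ ℚᵘ.mkℚᵘ (ℤ.+ m) 0 ℚᵘ.+ ℚᵘ.mkℚᵘ (ℤ.+ n) 0
  integral-sum = ℚᵘ.*≡* (trans (ℤ.*-identityʳ _) (trans (ℤ.pos-+ m n) (sym (trans (ℤ.*-identityʳ _)
                   (cong₂ ℤ._+_ (ℤ.*-identityʳ (ℤ.+ m)) (ℤ.*-identityʳ (ℤ.+ n)))))))

ℕ→ℚ-homo-* : ∀ m n → ℕ→ℚ (m ℕ.* n) ≡ ℕ→ℚ m * ℕ→ℚ n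
ℕ→ℚ-homo-* m n = toℚᵘ-injective (begin
  toℚᵘ (ℕ→ℚ (m ℕ.* n))                  ≈⟨ ℕ→ℚᵘ-≃ (m ℕ.* n) ⟩
  ℚᵘ.mkℚᵘ (ℤ.+ (m ℕ.* n)) 0               ≈⟨ ℚᵘ.*≡* (cong (ℤ._* ℤ.+ 1) (ℤ.pos-* m n)) ⟩
  ℚᵘ.mkℚᵘ (ℤ.+ m) 0 ℚᵘ.* ℚᵘ.mkℚᵘ (ℤ.+ n) 0  ≈⟨ ℚᵘ.*-cong (ℚᵘ.≃-sym (ℕ→ℚᵘ-≃ m)) (ℚᵘ.≃-sym (ℕ→ℚᵘ-≃ n)) ⟩
  toℚᵘ (ℕ→ℚ m) ℚᵘ.* toℚᵘ (ℕ→ℚ n)        ≈⟨ ℚᵘ.≃-sym (toℚᵘ-homo-* (ℕ→ℚ m) (ℕ→ℚ n)) ⟩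
  toℚᵘ (ℕ→ℚ m * ℕ→ℚ n)                  ∎)
  where open import Relation.Binary.Reasoning.Setoid ℚᵘ.≃-setoid

ℕ→ℚ-nonNeg : ∀ n → 0ℚ ≤ ℕ→ℚ n
ℕ→ℚ-nonNeg n = nonNegative⁻¹ (ℕ→ℚ n) {{normalize-nonNeg n 1}}

ℕ→ℚ-mono-≤ : ∀ {m n} → m ℕ.≤ n → ℕ→ℚ m ≤ ℕ→ℚ n
ℕ→ℚ-mono-≤ {m} m≤n with o , refl ← ℕ.m≤n⇒∃[o]m+o≡n m≤n = begin
  ℕ→ℚ m          ≡⟨ +-identityʳ (ℕ→ℚ m) ⟨
  ℕ→ℚ m + 0ℚ     ≤⟨ +-monoʳ-≤ (ℕ→ℚ m) (ℕ→ℚ-nonNeg o) ⟩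
  ℕ→ℚ m + ℕ→ℚ o  ≡⟨ ℕ→ℚ-homo-+ m o ⟨
  ℕ→ℚ (m ℕ.+ o)  ∎
  where open ≤-Reasoning

All-≤-foldr-⊔ : ∀ {A : Set} (f : A → ℕ) xs → All (λ x → f x ℕ.≤ foldr _⊔_ 0 (map f xs)) xs
All-≤-foldr-⊔ f []       = []
All-≤-foldr-⊔ f (x ∷ xs) =
  ℕ.m≤m⊔n (f x) _ ∷ All.map (λ fy≤ → ℕ.≤-trans fy≤ (ℕ.m≤n⊔m (f x) _)) (All-≤-foldr-⊔ f xs)

∑ : {A : Set} → (A → ℚ) → List A → ℚ
∑ f xs = sumℚ (map f xs)

module _ {A : Set} where

  ∑-++ : ∀ (f : A → ℚ) xs ys → ∑ f (xs ++ ys) ≡ ∑ f xs + ∑ f ys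
  ∑-++ f []       ys = sym (+-identityˡ (∑ f ys))
  ∑-++ f (x ∷ xs) ys = trans (cong (f x +_) (∑-++ f xs ys)) (sym (+-assoc (f x) (∑ f xs) (∑ f ys)))

  ∑-+ : ∀ (f g : A → ℚ) xs → ∑ (λ x → f x + g x) xs ≡ ∑ f xs + ∑ g xs
  ∑-+ f g []       = refl
  ∑-+ f g (x ∷ xs) =
    trans (cong (f x + g x +_) (∑-+ f g xs)) (+-interchange (f x) (g x) (∑ f xs) (∑ g xs))

  ∑-*ˡ : ∀ c (f : A → ℚ) xs → ∑ (λ x → c * f x) xs ≡ c * ∑ f xs
  ∑-*ˡ c f []       = sym (*-zeroʳ c)
  ∑-*ˡ c f (x ∷ xs) = trans (cong (c * f x +_) (∑-*ˡ c f xs)) (sym (*-distribˡ-+ c (f x) (∑ f xs)))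

  ∑-cong : ∀ {f g : A → ℚ} xs → (∀ {x} → x ∈ xs → f x ≡ g x) → ∑ f xs ≡ ∑ g xs
  ∑-cong []       f≡g = refl
  ∑-cong (x ∷ xs) f≡g = cong₂ _+_ (f≡g (here refl)) (∑-cong xs (λ x∈ → f≡g (there x∈)))

  ∑-zero : ∀ {f : A → ℚ} xs → (∀ {x} → x ∈ xs → f x ≡ 0ℚ) → ∑ f xs ≡ 0ℚ
  ∑-zero []       f≡0 = refl
  ∑-zero (x ∷ xs) f≡0 = cong₂ _+_ (f≡0 (here refl)) (∑-zero xs (λ x∈ → f≡0 (there x∈)))

  ∑-mono-≤ : ∀ {f g : A → ℚ} xs → (∀ {x} → x ∈ xs → f x ≤ g x) → ∑ f xs ≤ ∑ g xs
  ∑-mono-≤ []       f≤g = ≤-refl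
  ∑-mono-≤ (x ∷ xs) f≤g = +-mono-≤ (f≤g (here refl)) (∑-mono-≤ xs (λ x∈ → f≤g (there x∈)))

  ∑-nonNeg : ∀ {f : A → ℚ} xs → (∀ {x} → x ∈ xs → 0ℚ ≤ f x) → 0ℚ ≤ ∑ f xs
  ∑-nonNeg {f} xs 0≤f = subst (_≤ ∑ f xs) (∑-zero xs (λ _ → refl)) (∑-mono-≤ xs 0≤f)

  ∈⇒≤∑ : ∀ {f : A → ℚ} {x} xs → (∀ {y} → y ∈ xs → 0ℚ ≤ f y) → x ∈ xs → f x ≤ ∑ f xs
  ∈⇒≤∑ {f} (y ∷ xs) 0≤f (here refl) = begin
    f y           ≡⟨ +-identityʳ (f y) ⟨
    f y + 0ℚ      ≤⟨ +-monoʳ-≤ (f y) (∑-nonNeg xs (λ y∈ → 0≤f (there y∈))) ⟩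
    f y + ∑ f xs  ∎
    where open ≤-Reasoning
  ∈⇒≤∑ {f} {x} (y ∷ xs) 0≤f (there x∈) = begin
    f x           ≤⟨ ∈⇒≤∑ xs (λ y∈ → 0≤f (there y∈)) x∈ ⟩
    ∑ f xs        ≡⟨ +-identityˡ (∑ f xs) ⟨
    0ℚ + ∑ f xs   ≤⟨ +-monoˡ-≤ (∑ f xs) (0≤f (here refl)) ⟩
    f y + ∑ f xs  ∎
    where open ≤-Reasoning

  ∑-const : ∀ k (xs : List A) → ∑ (λ _ → k) xs ≡ k * ℕ→ℚ (length xs)
  ∑-const k []       = sym (*-zeroʳ k)
  ∑-const k (x ∷ xs) = begin
    k + ∑ (λ _ → k) xs             ≡⟨ cong (k +_) (∑-const k xs) ⟩
    k + k * ℕ→ℚ (length xs)        ≡⟨ solve 2 (λ k n → k :+ k :* n := k :* (con 1ℚ :+ n)) refl k (ℕ→ℚ (length xs)) ⟩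
    k * (1ℚ + ℕ→ℚ (length xs))     ≡⟨ cong (k *_) (ℕ→ℚ-homo-+ 1 (length xs)) ⟨
    k * ℕ→ℚ (length (x ∷ xs))      ∎
    where open ≡-Reasoning

∑-comm : ∀ {A B : Set} (f : A → B → ℚ) xs ys →
         ∑ (λ x → ∑ (f x) ys) xs ≡ ∑ (λ y → ∑ (λ x → f x y) xs) ys
∑-comm f []       ys = sym (∑-zero ys (λ _ → refl))
∑-comm f (x ∷ xs) ys =
  trans (cong (∑ (f x) ys +_) (∑-comm f xs ys)) (sym (∑-+ (f x) (λ y → ∑ (λ x′ → f x′ y) xs) ys))

χ : ∀ {n} → Fin n → List (Fin n) → ℚ → ℚ
χ e es k = if does (e ∈ᶠ? es) then k else 0ℚ

module _ {n : ℕ} where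

  χ-∈ : ∀ {e : Fin n} es k → e ∈ es → χ e es k ≡ k
  χ-∈ {e} es k = if-does-yes (e ∈ᶠ? es)

  χ-∉ : ∀ {e : Fin n} es k → e ∉ es → χ e es k ≡ 0ℚ
  χ-∉ {e} es k = if-does-no (e ∈ᶠ? es)

  χ-nonNeg : ∀ {k} (e : Fin n) es → 0ℚ ≤ k → 0ℚ ≤ χ e es k
  χ-nonNeg e es 0≤k = if-nonNeg 0≤k (does (e ∈ᶠ? es))

  *-χ-comm : ∀ c k (e : Fin n) es → c * χ e es k ≡ k * χ e es c
  *-χ-comm c k e es with e ∈ᶠ? es
  ... | yes _ = *-comm c k
  ... | no  _ = trans (*-zeroʳ c) (sym (*-zeroʳ k))

  χ-∷ : ∀ k (e x : Fin n) es → x ∉ es → χ e [ x ] k + χ e es k ≡ χ e (x ∷ es) k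
  χ-∷ k e x es x∉es = by-cases (e Fin.≟ x) (e ∈ᶠ? es)
    where
    open ≡-Reasoning
    by-cases : Dec (e ≡ x) → Dec (e ∈ es) → χ e [ x ] k + χ e es k ≡ χ e (x ∷ es) k
    by-cases (yes refl) _ = begin
      χ e [ e ] k + χ e es k  ≡⟨ cong₂ _+_ (χ-∈ [ e ] k (here refl)) (χ-∉ es k x∉es) ⟩
      k + 0ℚ                  ≡⟨ +-identityʳ k ⟩
      k                       ≡⟨ χ-∈ (e ∷ es) k (here refl) ⟨
      χ e (e ∷ es) k          ∎
    by-cases (no e≢x) e∈es? = begin
      χ e [ x ] k + χ e es k  ≡⟨ cong (_+ χ e es k) (χ-∉ [ x ] k e∉[x]) ⟩
      0ℚ + χ e es k           ≡⟨ +-identityˡ (χ e es k) ⟩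
      χ e es k                ≡⟨ same-membership e∈es? ⟩
      χ e (x ∷ es) k          ∎
      where
      e∉[x] : e ∉ [ x ]
      e∉[x] (here e≡x) = e≢x e≡x
      same-membership : Dec (e ∈ es) → χ e es k ≡ χ e (x ∷ es) k
      same-membership (yes e∈es) = trans (χ-∈ es k e∈es) (sym (χ-∈ (x ∷ es) k (there e∈es)))
      same-membership (no e∉es)  = trans (χ-∉ es k e∉es) (sym (χ-∉ (x ∷ es) k e∉x∷es))
        where
        e∉x∷es : e ∉ x ∷ es
        e∉x∷es (here e≡x)  = e≢x e≡x
        e∉x∷es (there e∈) = e∉es e∈

  χ-≤-∑χ : ∀ {k} (x : Fin n) Q → 0ℚ ≤ k → χ x Q k ≤ ∑ (λ e → χ e [ x ] k) Q
  χ-≤-∑χ {k} x Q 0≤k = by-cases (x ∈ᶠ? Q)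
    where
    open ≤-Reasoning
    0≤χ : ∀ {e} → e ∈ Q → 0ℚ ≤ χ e [ x ] k
    0≤χ {e} _ = χ-nonNeg e [ x ] 0≤k
    by-cases : Dec (x ∈ Q) → χ x Q k ≤ ∑ (λ e → χ e [ x ] k) Q
    by-cases (yes x∈Q) = begin
      χ x Q k                  ≡⟨ χ-∈ Q k x∈Q ⟩
      k                        ≡⟨ χ-∈ [ x ] k (here refl) ⟨
      χ x [ x ] k              ≤⟨ ∈⇒≤∑ Q 0≤χ x∈Q ⟩
      ∑ (λ e → χ e [ x ] k) Q  ∎
    by-cases (no x∉Q) = begin
      χ x Q k                  ≡⟨ χ-∉ Q k x∉Q ⟩
      0ℚ                       ≤⟨ ∑-nonNeg Q 0≤χ ⟩
      ∑ (λ e → χ e [ x ] k) Q  ∎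

  ∑χ-≤-∑χ : ∀ {k} (P Q : List (Fin n)) → Unique P → 0ℚ ≤ k →
            ∑ (λ e → χ e Q k) P ≤ ∑ (λ e → χ e P k) Q
  ∑χ-≤-∑χ     []      Q []                    0≤k = ∑-nonNeg Q (λ _ → ≤-refl)
  ∑χ-≤-∑χ {k} (x ∷ P) Q (x∉P ∷ uniqueP) 0≤k = begin
    χ x Q k + ∑ (λ e → χ e Q k) P                           ≤⟨ +-mono-≤ (χ-≤-∑χ x Q 0≤k) (∑χ-≤-∑χ P Q uniqueP 0≤k) ⟩
    ∑ (λ e → χ e [ x ] k) Q + ∑ (λ e → χ e P k) Q          ≡⟨ ∑-+ (λ e → χ e [ x ] k) (λ e → χ e P k) Q ⟨
    ∑ (λ e → χ e [ x ] k + χ e P k) Q                       ≡⟨ ∑-cong Q (λ {e} _ → χ-∷ k e x P (All.All¬⇒¬Any x∉P)) ⟩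
    ∑ (λ e → χ e (x ∷ P) k) Q                               ∎
    where open ≤-Reasoning

ratio : ℕ → ℚ
ratio Δ = 1ℚ + ℕ→ℚ 2 * ℕ→ℚ Δ * ℕ→ℚ Δ

ratio-nonNeg : ∀ Δ → 0ℚ ≤ ratio Δ
ratio-nonNeg Δ = +-nonNeg 0≤1 (*-nonNeg (*-nonNeg (ℕ→ℚ-nonNeg 2) (ℕ→ℚ-nonNeg Δ)) (ℕ→ℚ-nonNeg Δ))

walk-owner : ∀ {N t u v es e} → Walk N t u v es → e ∈ es → Network.owner N e ≡ t
walk-owner (step owned _ _) (here refl) = owned
walk-owner (step _ _ walk)  (there e∈)  = walk-owner walk e∈

module _ (N : Network) where
  open Network N

  -- incβ N r is definitionally λ e → χ e (Raise.crit r) (βinc r).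
  βinc : Raise K E → ℚ
  βinc r = ℕ→ℚ (2 ℕ.* length (Raise.crit r)) * Raise.δ r

  gain : Raise K E → Fin K → ℚ
  gain r x = incα N r (dem x) + h N x * ∑ (incβ N r) (path x)

  load≡∑χ : ∀ S e → load N S e ≡ ∑ (λ x → χ e (path x) (h N x)) S
  load≡∑χ []      e = refl
  load≡∑χ (x ∷ S) e with e ∈ᶠ? path x
  ... | yes _ = cong (h N x +_) (load≡∑χ S e)
  ... | no  _ = trans (load≡∑χ S e) (sym (+-identityˡ _))

  load-++ : ∀ S T e → load N (S ++ T) e ≡ load N S e + load N T e
  load-++ S T e = begin
    load N (S ++ T) e                                                      ≡⟨ load≡∑χ (S ++ T) e ⟩
    ∑ (λ x → χ e (path x) (h N x)) (S ++ T)                                ≡⟨ ∑-++ _ S T ⟩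
    ∑ (λ x → χ e (path x) (h N x)) S + ∑ (λ x → χ e (path x) (h N x)) T    ≡⟨ cong₂ _+_ (load≡∑χ S e) (load≡∑χ T e) ⟨
    load N S e + load N T e                                                ∎
    where open ≡-Reasoning

  load-∷ʳ : ∀ S d e → load N (S ++ [ d ]) e ≡ load N S e + χ e (path d) (h N d)
  load-∷ʳ S d e = trans (load-++ S [ d ] e)
    (cong (load N S e +_) (trans (load≡∑χ [ d ] e) (+-identityʳ (χ e (path d) (h N d)))))

  load-zero : ∀ S e → (∀ {x} → x ∈ S → e ∉ path x) → load N S e ≡ 0ℚ
  load-zero S e off = trans (load≡∑χ S e) (∑-zero S (λ {x} x∈S → χ-∉ (path x) (h N x) (off x∈S)))

  incα-same : ∀ r {x} → dem x ≡ dem (Raise.inst r) → incα N r (dem x) ≡ Raise.δ r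
  incα-same r {x} = if-does-yes (dem x Fin.≟ dem (Raise.inst r))

  incα-other : ∀ r {x} → dem x ≢ dem (Raise.inst r) → incα N r (dem x) ≡ 0ℚ
  incα-other r {x} = if-does-no (dem x Fin.≟ dem (Raise.inst r))

  lhs-iterate : ∀ D I x → lhs N (iterate N D I) x ≡ lhs N D x + ∑ (λ r → gain r x) I
  lhs-iterate D I x = begin
    (a + ∑αI) + h N x * ∑ (λ e → Duals.β D e + ∑ (λ r → incβ N r e) I) (path x)  ≡⟨ cong (λ t → a + ∑αI + h N x * t) β-sum ⟩
    (a + ∑αI) + h N x * (b + ∑βI)                                                 ≡⟨ regroup a ∑αI (h N x) b ∑βI ⟩
    (a + h N x * b) + (∑αI + h N x * ∑βI)                                         ≡⟨ cong (lhs N D x +_) gain-sum ⟨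
    lhs N D x + ∑ (λ r → gain r x) I                                              ∎
    where
    open ≡-Reasoning
    a : ℚ
    a = Duals.α D (dem x)
    b : ℚ
    b = ∑ (Duals.β D) (path x)
    ∑αI : ℚ
    ∑αI = ∑ (λ r → incα N r (dem x)) I
    ∑βI : ℚ
    ∑βI = ∑ (λ r → ∑ (incβ N r) (path x)) I
    β-sum : ∑ (λ e → Duals.β D e + ∑ (λ r → incβ N r e) I) (path x) ≡ b + ∑βI
    β-sum = trans (∑-+ (Duals.β D) _ (path x)) (cong (b +_) (∑-comm (λ e r → incβ N r e) (path x) I))
    gain-sum : ∑ (λ r → gain r x) I ≡ ∑αI + h N x * ∑βI
    gain-sum = trans (∑-+ _ _ I) (cong (∑αI +_) (∑-*ˡ (h N x) (λ r → ∑ (incβ N r) (path x)) I))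
    regroup : ∀ a s c b t → (a + s) + c * (b + t) ≡ (a + c * b) + (s + c * t)
    regroup = solve 5 (λ a s c b t → (a :+ s) :+ c :* (b :+ t) := (a :+ c :* b) :+ (s :+ c :* t)) refl

  ∑-lhs-iterate : ∀ D I S →
    ∑ (lhs N (iterate N D I)) S ≡ ∑ (lhs N D) S + ∑ (λ r → ∑ (gain r) S) I
  ∑-lhs-iterate D I S = begin
    ∑ (lhs N (iterate N D I)) S                                 ≡⟨ ∑-cong S (λ {x} _ → lhs-iterate D I x) ⟩
    ∑ (λ x → lhs N D x + ∑ (λ r → gain r x) I) S                ≡⟨ ∑-+ (lhs N D) _ S ⟩
    ∑ (lhs N D) S + ∑ (λ x → ∑ (λ r → gain r x) I) S            ≡⟨ cong (∑ (lhs N D) S +_) (∑-comm (λ x r → gain r x) S I) ⟩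
    ∑ (lhs N D) S + ∑ (λ r → ∑ (gain r) S) I                    ∎
    where open ≡-Reasoning

  ∑-lhs-zeroDuals : ∀ S → ∑ (lhs N (zeroDuals N)) S ≡ 0ℚ
  ∑-lhs-zeroDuals S = ∑-zero S (λ {x} _ → begin
    0ℚ + h N x * ∑ (λ _ → 0ℚ) (path x)  ≡⟨ +-identityˡ _ ⟩
    h N x * ∑ (λ _ → 0ℚ) (path x)       ≡⟨ cong (h N x *_) (∑-zero (path x) (λ _ → refl)) ⟩
    h N x * 0ℚ                          ≡⟨ *-zeroʳ (h N x) ⟩
    0ℚ                                  ∎)
    where open ≡-Reasoning

  phase2-∷ : ∀ I run → phase2 N (I ∷ run) ≡ popSet N (phase2 N run) I
  phase2-∷ I run = trans (cong (foldl (popSet N) []) (List.unfold-reverse I run))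
                         (List.foldl-∷ʳ (popSet N) [] I (reverse run))

  infeasible-∷ʳ : ∀ X d → Feasible N X → ¬ Feasible N (X ++ [ d ]) →
    (∃ λ x → x ∈ X × dem x ≡ dem d) ⊎ (∃ λ e → e ∈ path d × 1ℚ < load N X e + h N d)
  infeasible-∷ʳ X d (distinct , fits) infeasible with any? (λ x → dem x Fin.≟ dem d) X
  ... | yes shared = inj₁ (find shared)
  ... | no ¬shared with Fin.all? (λ e → load N (X ++ [ d ]) e ≤? 1ℚ)
  ...   | yes fits′ = contradiction (AllPairs.++⁺ distinct ([] ∷ []) (All.map (_∷ []) (All.¬Any⇒All¬ X ¬shared)) , fits′) infeasible
  ...   | no ¬fits′ with e , ¬fits ← Fin.¬∀⟶∃¬ E _ (λ e → load N (X ++ [ d ]) e ≤? 1ℚ) ¬fits′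
    = inj₂ (e , on-path (e ∈ᶠ? path d))
    where
    overfull : 1ℚ < load N X e + χ e (path d) (h N d)
    overfull = subst (1ℚ <_) (load-∷ʳ X d e) (≰⇒> ¬fits)
    on-path : Dec (e ∈ path d) → e ∈ path d × 1ℚ < load N X e + h N d
    on-path (yes e∈d) = e∈d , subst (λ t → 1ℚ < load N X e + t) (χ-∈ (path d) (h N d) e∈d) overfull
    on-path (no  e∉d) = ⊥-elim (<-irrefl refl (<-≤-trans 1<load (fits e)))
      where
      1<load : 1ℚ < load N X e
      1<load = subst (1ℚ <_) (trans (cong (load N X e +_) (χ-∉ (path d) (h N d) e∉d)) (+-identityʳ _)) overfull

  Covers : Raise K E → Fin K → Set
  Covers r x = Overlap N (Raise.inst r) x → ∃ λ e → e ∈ Raise.crit r × e ∈ path x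

  interference-covers : ∀ {I run} → Interference N (I ∷ run) →
                        ∀ {r x} → r ∈ I → x ∈ map Raise.inst (concat run) → Covers r x
  interference-covers {run = run} (interferes , _) r∈I x∈
    with r′ , r′∈ , refl ← ∈.∈-map⁻ Raise.inst x∈
    with J , r′∈J , J∈run ← ∈.∈-concat⁻′ run r′∈
    = interferes r∈I J∈run r′∈J

  -- Each raise pays its δ either from the
  -- slack of its own instance, if that was added, or from what it gained on the earlier solution S′.
  record Popped (D : Duals A E) (S′ : List (Fin K)) (L : List (Raise K E)) (X Y : List (Fin K)) : Set where
    field
      added    : List (Fin K)
      extends  : Y ≡ X ++ added
      added⊆   : added ⊆ map Raise.inst L
      feasible : Feasible N Y
      bound    : ∑ (lhs N D) added + ∑ Raise.δ L ≤ ∑ (p N) added + ∑ (λ r → ∑ (gain r) S′) L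

  popped-[] : ∀ {D S′ X} → Feasible N X → Popped D S′ [] X X
  popped-[] {X = X} feasible = record
    { added = [] ; extends = sym (List.++-identityʳ X) ; added⊆ = λ () ; feasible = feasible ; bound = ≤-refl }

  popped-added : ∀ {D S′ r L X Y} → Popped D S′ L (X ++ [ Raise.inst r ]) Y →
                 lhs N D (Raise.inst r) + Raise.δ r ≤ p N (Raise.inst r) + ∑ (gain r) S′ →
                 Popped D S′ (r ∷ L) X Y
  popped-added {D} {S′} {r} {L} {X} popped paid = record
    { added    = d ∷ added
    ; extends  = trans extends (List.++-assoc X [ d ] added)
    ; added⊆   = λ { (here refl) → here refl ; (there x∈) → there (added⊆ x∈) }
    ; feasible = feasible
    ; bound    = subst₂ _≤_
        (+-interchange (lhs N D d) (Raise.δ r) (∑ (lhs N D) added) (∑ Raise.δ L))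
        (+-interchange (p N d) (∑ (gain r) S′) (∑ (p N) added) (∑ (λ r′ → ∑ (gain r′) S′) L))
        (+-mono-≤ paid bound)
    }
    where
    open Popped popped
    d : Fin K
    d = Raise.inst r

  popped-blocked : ∀ {D S′ r L X Y} → Popped D S′ L X Y → Raise.δ r ≤ ∑ (gain r) S′ → Popped D S′ (r ∷ L) X Y
  popped-blocked {D} {S′} {r} {L} popped paid = record
    { added    = added
    ; extends  = extends
    ; added⊆   = λ x∈ → there (added⊆ x∈)
    ; feasible = feasible
    ; bound    = subst₂ _≤_
        (+-left-comm (Raise.δ r) (∑ (lhs N D) added) (∑ Raise.δ L))
        (+-left-comm (∑ (gain r) S′) (∑ (p N) added) (∑ (λ r′ → ∑ (gain r′) S′) L))
        (+-mono-≤ paid bound)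
    }
    where open Popped popped

  record Phase2Invariant (D : Duals A E) (run : List (List (Raise K E))) (S : List (Fin K)) : Set where
    field
      feasible : Feasible N S
      raised   : S ⊆ map Raise.inst (concat run)
      bound    : ∑ (lhs N D) S + ∑ Raise.δ (concat run) ≤ profitSum N S

  module _ (path-valid : ∀ d → ValidPath N d) (height-nonNeg : ∀ a → 0ℚ ≤ height a) where

    h-nonNeg : ∀ d → 0ℚ ≤ h N d
    h-nonNeg d = height-nonNeg (dem d)

    shared-edge⇒overlap : ∀ {e d x} → e ∈ path d → e ∈ path x → Overlap N d x
    shared-edge⇒overlap {e} {d} {x} e∈d e∈x =
      trans (sym (walk-owner (proj₁ (path-valid d)) e∈d)) (walk-owner (proj₁ (path-valid x)) e∈x) , e , e∈d , e∈x

    raise-factor : Raise K E → ℚ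
    raise-factor r = 1ℚ + ℕ→ℚ 2 * h N (Raise.inst r) * ℕ→ℚ (length (Raise.crit r) ℕ.* length (Raise.crit r))

    1≤raise-factor : ∀ r → 1ℚ ≤ raise-factor r
    1≤raise-factor r = +-monoʳ-≤ 1ℚ
      (*-nonNeg (*-nonNeg (ℕ→ℚ-nonNeg 2) (h-nonNeg (Raise.inst r))) (ℕ→ℚ-nonNeg (L ℕ.* L)))
      where
      L : ℕ
      L = length (Raise.crit r)

    valid-δ-nonNeg : ∀ {D r} → ValidRaise N D r → 0ℚ ≤ Raise.δ r
    valid-δ-nonNeg {D} {r} (0<slack , _ , _ , δ*factor≡slack) =
      *-cancelʳ-≤-pos (raise-factor r) {{positive (<-≤-trans (positive⁻¹ 1ℚ) (1≤raise-factor r))}} (begin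
        0ℚ * raise-factor r                         ≡⟨ *-zeroˡ (raise-factor r) ⟩
        0ℚ                                          ≤⟨ <⇒≤ 0<slack ⟩
        p N (Raise.inst r) - lhs N D (Raise.inst r)  ≡⟨ δ*factor≡slack ⟨
        Raise.δ r * raise-factor r                  ∎)
      where open ≤-Reasoning

    valid-lhs+δ≤p : ∀ {D r} → ValidRaise N D r → lhs N D (Raise.inst r) + Raise.δ r ≤ p N (Raise.inst r)
    valid-lhs+δ≤p {D} {r} valid@(_ , _ , _ , δ*factor≡slack) = begin
      ℓ + δ                    ≡⟨ cong (ℓ +_) (*-identityʳ δ) ⟨
      ℓ + δ * 1ℚ               ≤⟨ +-monoʳ-≤ ℓ (*-monoˡ-≤-0≤ (valid-δ-nonNeg {D} {r} valid) (1≤raise-factor r)) ⟩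
      ℓ + δ * raise-factor r   ≡⟨ cong (ℓ +_) δ*factor≡slack ⟩
      ℓ + (q - ℓ)              ≡⟨ solve 2 (λ ℓ q → ℓ :+ (q :- ℓ) := q) refl ℓ q ⟩
      q                        ∎
      where
      open ≤-Reasoning
      δ : ℚ
      δ = Raise.δ r
      ℓ : ℚ
      ℓ = lhs N D (Raise.inst r)
      q : ℚ
      q = p N (Raise.inst r)

    βinc-nonNeg : ∀ r → 0ℚ ≤ Raise.δ r → 0ℚ ≤ βinc r
    βinc-nonNeg r 0≤δ = *-nonNeg (ℕ→ℚ-nonNeg (2 ℕ.* length (Raise.crit r))) 0≤δ

    β-part-nonNeg : ∀ r x → 0ℚ ≤ Raise.δ r → 0ℚ ≤ h N x * ∑ (incβ N r) (path x)
    β-part-nonNeg r x 0≤δ = *-nonNeg (h-nonNeg x) (∑-nonNeg (path x) (λ {e} _ → χ-nonNeg e (Raise.crit r) (βinc-nonNeg r 0≤δ)))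

    incα≤gain : ∀ r x → 0ℚ ≤ Raise.δ r → incα N r (dem x) ≤ gain r x
    incα≤gain r x 0≤δ = begin
      incα N r (dem x)       ≡⟨ +-identityʳ _ ⟨
      incα N r (dem x) + 0ℚ  ≤⟨ +-monoʳ-≤ (incα N r (dem x)) (β-part-nonNeg r x 0≤δ) ⟩
      gain r x               ∎
      where open ≤-Reasoning

    β-part≤gain : ∀ r x → 0ℚ ≤ Raise.δ r → h N x * ∑ (incβ N r) (path x) ≤ gain r x
    β-part≤gain r x 0≤δ = begin
      h N x * ∑ (incβ N r) (path x)        ≡⟨ +-identityˡ _ ⟨
      0ℚ + h N x * ∑ (incβ N r) (path x)   ≤⟨ +-monoˡ-≤ _ (if-nonNeg 0≤δ (does (dem x Fin.≟ dem (Raise.inst r)))) ⟩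
      gain r x                             ∎
      where open ≤-Reasoning

    gain-nonNeg : ∀ r x → 0ℚ ≤ Raise.δ r → 0ℚ ≤ gain r x
    gain-nonNeg r x 0≤δ = ≤-trans (β-part-nonNeg r x 0≤δ) (β-part≤gain r x 0≤δ)

    ∑-incα≤δ : ∀ r O → AllPairs (λ x y → dem x ≢ dem y) O → 0ℚ ≤ Raise.δ r →
               ∑ (λ x → incα N r (dem x)) O ≤ Raise.δ r
    ∑-incα≤δ r []      _                 0≤δ = 0≤δ
    ∑-incα≤δ r (x ∷ O) (x≢O ∷ distinct) 0≤δ = by-cases (dem x Fin.≟ dem (Raise.inst r))
      where
      open ≤-Reasoning
      others-zero : dem x ≡ dem (Raise.inst r) → ∀ {y} → y ∈ O → incα N r (dem y) ≡ 0ℚ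
      others-zero x∼r y∈O = incα-other r (λ y∼r → All.lookup x≢O y∈O (trans x∼r (sym y∼r)))
      by-cases : Dec (dem x ≡ dem (Raise.inst r)) → ∑ (λ y → incα N r (dem y)) (x ∷ O) ≤ Raise.δ r
      by-cases (yes x∼r) = ≤-reflexive (begin-equality
        incα N r (dem x) + ∑ (λ y → incα N r (dem y)) O  ≡⟨ cong₂ _+_ (incα-same r x∼r) (∑-zero O (others-zero x∼r)) ⟩
        Raise.δ r + 0ℚ                                   ≡⟨ +-identityʳ (Raise.δ r) ⟩
        Raise.δ r                                        ∎)
      by-cases (no x≁r) = begin
        incα N r (dem x) + ∑ (λ y → incα N r (dem y)) O  ≡⟨ cong (_+ _) (incα-other r x≁r) ⟩
        0ℚ + ∑ (λ y → incα N r (dem y)) O                ≡⟨ +-identityˡ _ ⟩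
        ∑ (λ y → incα N r (dem y)) O                     ≤⟨ ∑-incα≤δ r O distinct 0≤δ ⟩
        Raise.δ r                                        ∎

    ∑-β-part≤ : ∀ r O → Feasible N O → 0ℚ ≤ Raise.δ r →
                ∑ (λ x → h N x * ∑ (incβ N r) (path x)) O ≤ βinc r * ℕ→ℚ (length (Raise.crit r))
    ∑-β-part≤ r O (_ , fits) 0≤δ = begin
      ∑ (λ x → h N x * ∑ (λ e → χ e π κ) (path x)) O  ≤⟨ ∑-mono-≤ O (λ {x} _ → *-monoˡ-≤-0≤ (h-nonNeg x)
                                                            (∑χ-≤-∑χ (path x) π (proj₂ (path-valid x)) 0≤κ)) ⟩
      ∑ (λ x → h N x * ∑ (λ e → χ e (path x) κ) π) O  ≡⟨ ∑-cong O (λ {x} _ → sym (∑-*ˡ (h N x) (λ e → χ e (path x) κ) π)) ⟩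
      ∑ (λ x → ∑ (λ e → h N x * χ e (path x) κ) π) O  ≡⟨ ∑-comm (λ x e → h N x * χ e (path x) κ) O π ⟩
      ∑ (λ e → ∑ (λ x → h N x * χ e (path x) κ) O) π  ≡⟨ ∑-cong π (λ {e} _ → κ-times-load e) ⟩
      ∑ (λ e → κ * load N O e) π                      ≤⟨ ∑-mono-≤ π (λ {e} _ → *-monoˡ-≤-0≤ 0≤κ (fits e)) ⟩
      ∑ (λ _ → κ * 1ℚ) π                              ≡⟨ ∑-const (κ * 1ℚ) π ⟩
      κ * 1ℚ * ℕ→ℚ (length π)                         ≡⟨ cong (_* ℕ→ℚ (length π)) (*-identityʳ κ) ⟩
      κ * ℕ→ℚ (length π)                              ∎
      where
      open ≤-Reasoning
      π : List (Fin E)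
      π = Raise.crit r
      κ : ℚ
      κ = βinc r
      0≤κ : 0ℚ ≤ κ
      0≤κ = βinc-nonNeg r 0≤δ
      κ-times-load : ∀ e → ∑ (λ x → h N x * χ e (path x) κ) O ≡ κ * load N O e
      κ-times-load e = begin-equality
        ∑ (λ x → h N x * χ e (path x) κ) O  ≡⟨ ∑-cong O (λ {x} _ → *-χ-comm (h N x) κ e (path x)) ⟩
        ∑ (λ x → κ * χ e (path x) (h N x)) O  ≡⟨ ∑-*ˡ κ (λ x → χ e (path x) (h N x)) O ⟩
        κ * ∑ (λ x → χ e (path x) (h N x)) O  ≡⟨ cong (κ *_) (load≡∑χ O e) ⟨
        κ * load N O e                        ∎

    ∑-gain≤ : ∀ {D} r M O → ValidRaise N D r → length (Raise.crit r) ℕ.≤ M → Feasible N O →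
              ∑ (gain r) O ≤ ratio M * Raise.δ r
    ∑-gain≤ {D} r M O valid L≤M feasible = begin
      ∑ (gain r) O
        ≡⟨ ∑-+ _ _ O ⟩
      ∑ (λ x → incα N r (dem x)) O + ∑ (λ x → h N x * ∑ (incβ N r) (path x)) O
        ≤⟨ +-mono-≤ (∑-incα≤δ r O (proj₁ feasible) 0≤δ) (∑-β-part≤ r O feasible 0≤δ) ⟩
      δ + ℕ→ℚ (2 ℕ.* L) * δ * ℕ→ℚ L
        ≡⟨ cong (δ +_) (solve 3 (λ a δ l → a :* δ :* l := δ :* (a :* l)) refl (ℕ→ℚ (2 ℕ.* L)) δ (ℕ→ℚ L)) ⟩
      δ + δ * (ℕ→ℚ (2 ℕ.* L) * ℕ→ℚ L)
        ≤⟨ +-monoʳ-≤ δ (*-monoˡ-≤-0≤ 0≤δ 2L²≤2M²) ⟩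
      δ + δ * (ℕ→ℚ 2 * ℕ→ℚ M * ℕ→ℚ M)
        ≡⟨ solve 2 (λ δ q → δ :+ δ :* q := (con 1ℚ :+ q) :* δ) refl δ (ℕ→ℚ 2 * ℕ→ℚ M * ℕ→ℚ M) ⟩
      ratio M * δ
        ∎
      where
      open ≤-Reasoning
      δ : ℚ
      δ = Raise.δ r
      L : ℕ
      L = length (Raise.crit r)
      0≤δ : 0ℚ ≤ δ
      0≤δ = valid-δ-nonNeg {D} {r} valid
      2L²≤2M² : ℕ→ℚ (2 ℕ.* L) * ℕ→ℚ L ≤ ℕ→ℚ 2 * ℕ→ℚ M * ℕ→ℚ M
      2L²≤2M² = begin
        ℕ→ℚ (2 ℕ.* L) * ℕ→ℚ L    ≡⟨ ℕ→ℚ-homo-* (2 ℕ.* L) L ⟨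
        ℕ→ℚ (2 ℕ.* L ℕ.* L)      ≤⟨ ℕ→ℚ-mono-≤ (ℕ.*-mono-≤ (ℕ.*-monoʳ-≤ 2 L≤M) L≤M) ⟩
        ℕ→ℚ (2 ℕ.* M ℕ.* M)      ≡⟨ ℕ→ℚ-homo-* (2 ℕ.* M) M ⟩
        ℕ→ℚ (2 ℕ.* M) * ℕ→ℚ M    ≡⟨ cong (_* ℕ→ℚ M) (ℕ→ℚ-homo-* 2 M) ⟩
        ℕ→ℚ 2 * ℕ→ℚ M * ℕ→ℚ M    ∎

    ∑-lhs-growth : ∀ M O → Feasible N O → ∀ D run → ValidRun N D run →
                   All (λ r → length (Raise.crit r) ℕ.≤ M) (concat run) →
                ∑ (lhs N (foldl (iterate N) D run)) O ≤ ∑ (lhs N D) O + ratio M * ∑ Raise.δ (concat run)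
    ∑-lhs-growth M O feasible D [] _ _ =
      ≤-reflexive (sym (trans (cong (∑ (lhs N D) O +_) (*-zeroʳ (ratio M))) (+-identityʳ _)))
    ∑-lhs-growth M O feasible D (I ∷ run) ((_ , validI) , valid-run) L≤M = begin
      ∑ (lhs N (foldl (iterate N) (iterate N D I) run)) O  ≤⟨ ∑-lhs-growth M O feasible (iterate N D I) run valid-run (All.++⁻ʳ I L≤M) ⟩
      ∑ (lhs N (iterate N D I)) O + c * T                  ≡⟨ cong (_+ c * T) (∑-lhs-iterate D I O) ⟩
      ∑ (lhs N D) O + ∑ (λ r → ∑ (gain r) O) I + c * T     ≤⟨ +-monoˡ-≤ (c * T) (+-monoʳ-≤ (∑ (lhs N D) O) gains≤) ⟩
      ∑ (lhs N D) O + c * ∑ Raise.δ I + c * T              ≡⟨ +-assoc (∑ (lhs N D) O) (c * ∑ Raise.δ I) (c * T) ⟩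
      ∑ (lhs N D) O + (c * ∑ Raise.δ I + c * T)            ≡⟨ cong (∑ (lhs N D) O +_) (*-distribˡ-+ c (∑ Raise.δ I) T) ⟨
      ∑ (lhs N D) O + c * (∑ Raise.δ I + T)                ≡⟨ cong (λ t → ∑ (lhs N D) O + c * t) (∑-++ Raise.δ I (concat run)) ⟨
      ∑ (lhs N D) O + c * ∑ Raise.δ (I ++ concat run)      ∎
      where
      open ≤-Reasoning
      c : ℚ
      c = ratio M
      T : ℚ
      T = ∑ Raise.δ (concat run)
      gains≤ : ∑ (λ r → ∑ (gain r) O) I ≤ c * ∑ Raise.δ I
      gains≤ = begin
        ∑ (λ r → ∑ (gain r) O) I  ≤⟨ ∑-mono-≤ I (λ r∈I → ∑-gain≤ {D} _ M O (All.lookup validI r∈I) (All.lookup (All.++⁻ˡ I L≤M) r∈I) feasible) ⟩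
        ∑ (λ r → c * Raise.δ r) I ≡⟨ ∑-*ˡ c Raise.δ I ⟩
        c * ∑ Raise.δ I           ∎

    ∑-lhs-phase1≤ : ∀ run O → Feasible N O → ValidRun N (zeroDuals N) run →
                    ∑ (lhs N (phase1 N run)) O ≤ ratio (Δ N run) * ∑ Raise.δ (concat run)
    ∑-lhs-phase1≤ run O feasible valid = begin
      ∑ (lhs N (phase1 N run)) O                              ≤⟨ ∑-lhs-growth (Δ N run) O feasible (zeroDuals N) run valid
                                                                   (All-≤-foldr-⊔ (λ r → length (Raise.crit r)) (concat run)) ⟩
      ∑ (lhs N (zeroDuals N)) O + ratio (Δ N run) * raised    ≡⟨ cong (_+ ratio (Δ N run) * raised) (∑-lhs-zeroDuals O) ⟩
      0ℚ + ratio (Δ N run) * raised                           ≡⟨ +-identityˡ _ ⟩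
      ratio (Δ N run) * raised                                ∎
      where
      open ≤-Reasoning
      raised : ℚ
      raised = ∑ Raise.δ (concat run)

    covered-gain : ∀ r x e → 0ℚ ≤ Raise.δ r → e ∈ path (Raise.inst r) → Covers r x →
                   ℕ→ℚ 2 * Raise.δ r * χ e (path x) (h N x) ≤ gain r x
    covered-gain r x e 0≤δ e∈d covers = by-cases (e ∈ᶠ? path x)
      where
      open ≤-Reasoning
      δ : ℚ
      δ = Raise.δ r
      π : List (Fin E)
      π = Raise.crit r
      by-cases : Dec (e ∈ path x) → ℕ→ℚ 2 * δ * χ e (path x) (h N x) ≤ gain r x
      by-cases (no e∉x) = begin
        ℕ→ℚ 2 * δ * χ e (path x) (h N x)  ≡⟨ cong (ℕ→ℚ 2 * δ *_) (χ-∉ (path x) (h N x) e∉x) ⟩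
        ℕ→ℚ 2 * δ * 0ℚ                    ≡⟨ *-zeroʳ (ℕ→ℚ 2 * δ) ⟩
        0ℚ                                ≤⟨ gain-nonNeg r x 0≤δ ⟩
        gain r x                          ∎
      by-cases (yes e∈x) with e′ , e′∈π , e′∈x ← covers (shared-edge⇒overlap e∈d e∈x) = begin
        ℕ→ℚ 2 * δ * χ e (path x) (h N x)  ≡⟨ cong (ℕ→ℚ 2 * δ *_) (χ-∈ (path x) (h N x) e∈x) ⟩
        ℕ→ℚ 2 * δ * h N x                 ≡⟨ *-comm (ℕ→ℚ 2 * δ) (h N x) ⟩
        h N x * (ℕ→ℚ 2 * δ)               ≤⟨ *-monoˡ-≤-0≤ (h-nonNeg x) (*-monoʳ-≤-0≤ 0≤δ (ℕ→ℚ-mono-≤ (ℕ.*-monoʳ-≤ 2 (∈.∈-length e′∈π)))) ⟩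
        h N x * βinc r                    ≡⟨ cong (h N x *_) (χ-∈ π (βinc r) e′∈π) ⟨
        h N x * incβ N r e′               ≤⟨ *-monoˡ-≤-0≤ (h-nonNeg x) (∈⇒≤∑ (path x) (λ {y} _ → χ-nonNeg y π (βinc-nonNeg r 0≤δ)) e′∈x) ⟩
        h N x * ∑ (incβ N r) (path x)     ≤⟨ β-part≤gain r x 0≤δ ⟩
        gain r x                          ∎

    heavy-edge-gain : ∀ r S e → 0ℚ ≤ Raise.δ r → e ∈ path (Raise.inst r) → All (Covers r) S →
                      ½ ≤ load N S e → Raise.δ r ≤ ∑ (gain r) S
    heavy-edge-gain r S e 0≤δ e∈d covers ½≤load = begin
      δ                                                   ≡⟨ solve 1 (λ δ → δ := con (ℕ→ℚ 2) :* δ :* con ½) refl δ ⟩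
      ℕ→ℚ 2 * δ * ½                                       ≤⟨ *-monoˡ-≤-0≤ (*-nonNeg (ℕ→ℚ-nonNeg 2) 0≤δ) ½≤load ⟩
      ℕ→ℚ 2 * δ * load N S e                              ≡⟨ cong (ℕ→ℚ 2 * δ *_) (load≡∑χ S e) ⟩
      ℕ→ℚ 2 * δ * ∑ (λ x → χ e (path x) (h N x)) S        ≡⟨ ∑-*ˡ (ℕ→ℚ 2 * δ) (λ x → χ e (path x) (h N x)) S ⟨
      ∑ (λ x → ℕ→ℚ 2 * δ * χ e (path x) (h N x)) S        ≤⟨ ∑-mono-≤ S (λ x∈S → covered-gain r _ e 0≤δ e∈d (All.lookup covers x∈S)) ⟩
      ∑ (gain r) S                                        ∎
      where
      open ≤-Reasoning
      δ : ℚ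
      δ = Raise.δ r

    same-demand-gain : ∀ r S {x} → 0ℚ ≤ Raise.δ r → x ∈ S → dem x ≡ dem (Raise.inst r) → Raise.δ r ≤ ∑ (gain r) S
    same-demand-gain r S {x} 0≤δ x∈S x∼r = begin
      Raise.δ r         ≡⟨ incα-same r x∼r ⟨
      incα N r (dem x)  ≤⟨ incα≤gain r x 0≤δ ⟩
      gain r x          ≤⟨ ∈⇒≤∑ S (λ {y} _ → gain-nonNeg r y 0≤δ) x∈S ⟩
      ∑ (gain r) S      ∎
      where open ≤-Reasoning

    module _ (narrow : ∀ a → height a ≤ ½) where

      blocked-gain : ∀ r S′ B → 0ℚ ≤ Raise.δ r → All (Covers r) S′ →
                     All (λ b → ¬ Conflict N b (Raise.inst r)) B →
                     Feasible N (S′ ++ B) → ¬ Feasible N ((S′ ++ B) ++ [ Raise.inst r ]) →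
                     Raise.δ r ≤ ∑ (gain r) S′
      blocked-gain r S′ B 0≤δ covers compatible feasible infeasible
        with infeasible-∷ʳ (S′ ++ B) (Raise.inst r) feasible infeasible
      ... | inj₁ (x , x∈ , x∼r) = shared-demand (∈.∈-++⁻ S′ x∈)
        where
        shared-demand : x ∈ S′ ⊎ x ∈ B → Raise.δ r ≤ ∑ (gain r) S′
        shared-demand (inj₁ x∈S′) = same-demand-gain r S′ 0≤δ x∈S′ x∼r
        shared-demand (inj₂ x∈B)  = contradiction (inj₂ x∼r) (All.lookup compatible x∈B)
      ... | inj₂ (e , e∈d , overfull) =
        heavy-edge-gain r S′ e 0≤δ e∈d covers (½≤-of-1<+ overfull′ (narrow (dem (Raise.inst r))))
        where
        B-off : ∀ {b} → b ∈ B → e ∉ path b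
        B-off b∈B e∈b = All.lookup compatible b∈B (inj₁ (shared-edge⇒overlap e∈b e∈d))
        load-S′ : load N (S′ ++ B) e ≡ load N S′ e
        load-S′ = trans (load-++ S′ B e) (trans (cong (load N S′ e +_) (load-zero B e B-off)) (+-identityʳ _))
        overfull′ : 1ℚ < load N S′ e + h N (Raise.inst r)
        overfull′ = subst (λ t → 1ℚ < t + h N (Raise.inst r)) load-S′ overfull

      pop-invariant : ∀ D S′ L X B → X ≡ S′ ++ B →
                      All (ValidRaise N D) L →
                      AllPairs (λ r r′ → ¬ Conflict N (Raise.inst r) (Raise.inst r′)) L →
                      All (λ r → All (Covers r) S′) L →
                      All (λ b → All (λ r → ¬ Conflict N b (Raise.inst r)) L) B →
                      Feasible N X →
                      Popped D S′ L X (foldl (tryAdd N) X (map Raise.inst L))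
      pop-invariant D S′ [] X B _ _ _ _ _ feasible = popped-[] feasible
      pop-invariant D S′ (r ∷ L) X B X≡ (valid ∷ validL) (r-compatible ∷ pairwise) (covers ∷ coversL) compatible feasible =
        by-cases (feasible? N (X ++ [ d ]))
        where
        d : Fin K
        d = Raise.inst r
        Result : List (Fin K) → Set
        Result Z = Popped D S′ (r ∷ L) X (foldl (tryAdd N) Z (map Raise.inst L))
        0≤δ : 0ℚ ≤ Raise.δ r
        0≤δ = valid-δ-nonNeg {D} {r} valid
        paid : lhs N D d + Raise.δ r ≤ p N d + ∑ (gain r) S′
        paid = begin
          lhs N D d + Raise.δ r        ≤⟨ valid-lhs+δ≤p {D} {r} valid ⟩
          p N d                        ≡⟨ +-identityʳ (p N d) ⟨
          p N d + 0ℚ                   ≤⟨ +-monoʳ-≤ (p N d) (∑-nonNeg S′ (λ {y} _ → gain-nonNeg r y 0≤δ)) ⟩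
          p N d + ∑ (gain r) S′        ∎
          where open ≤-Reasoning
        by-cases : (d? : Dec (Feasible N (X ++ [ d ]))) → Result (if does d? then X ++ [ d ] else X)
        by-cases d?@(yes feasible′) = subst Result (sym (if-does-yes d? {y = X} feasible′))
          (popped-added (pop-invariant D S′ L (X ++ [ d ]) (B ++ [ d ])
             (trans (cong (_++ [ d ]) X≡) (List.++-assoc S′ B [ d ]))
             validL pairwise coversL
             (All.++⁺ (All.map All.tail compatible) (r-compatible ∷ [])) feasible′) paid)
        by-cases d?@(no infeasible) = subst Result (sym (if-does-no d? {x = X ++ [ d ]} infeasible))
          (popped-blocked (pop-invariant D S′ L X B X≡ validL pairwise coversL (All.map All.tail compatible) feasible)
             (blocked-gain r S′ B 0≤δ covers (All.map All.head compatible)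
               (subst (Feasible N) X≡ feasible) (subst (λ Z → ¬ Feasible N (Z ++ [ d ])) X≡ infeasible)))

      phase2-invariant : ∀ D run → ValidRun N D run → Interference N run → Phase2Invariant D run (phase2 N run)
      phase2-invariant D []        _ _ = record { feasible = [] , (λ _ → 0≤1) ; raised = λ () ; bound = ≤-refl }
      phase2-invariant D (I ∷ run) ((pairwise , validI) , valid-run) interference@(_ , interference′) =
        subst (Phase2Invariant D (I ∷ run)) (sym (trans (phase2-∷ I run) extends)) (record
          { feasible = subst (Feasible N) extends feasible
          ; raised   = raised′
          ; bound    = subst₂ _≤_
              (sym (cong₂ _+_ (∑-++ (lhs N D) S′ added) (∑-++ Raise.δ I (concat run))))
              (sym (∑-++ (p N) S′ added))
              (+-transfer-≤ (∑ (lhs N D) S′) (∑ (lhs N D) added) (∑ Raise.δ I) (∑ Raise.δ (concat run))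
                 (∑ (λ r → ∑ (gain r) S′) I) earlier bound)
          })
        where
        S′ : List (Fin K)
        S′ = phase2 N run
        module IH = Phase2Invariant (phase2-invariant (iterate N D I) run valid-run interference′)
        covers : All (λ r → All (Covers r) S′) I
        covers = All.tabulate (λ r∈I → All.tabulate (λ x∈S′ → interference-covers interference r∈I (IH.raised x∈S′)))
        open Popped (pop-invariant D S′ I S′ [] (sym (List.++-identityʳ S′)) validI pairwise covers [] IH.feasible)
        earlier : ∑ (lhs N D) S′ + ∑ (λ r → ∑ (gain r) S′) I + ∑ Raise.δ (concat run) ≤ ∑ (p N) S′
        earlier = subst (λ t → t + ∑ Raise.δ (concat run) ≤ ∑ (p N) S′) (∑-lhs-iterate D I S′) IH.bound
        raised′ : S′ ++ added ⊆ map Raise.inst (I ++ concat run)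
        raised′ {x} x∈ = subst (x ∈_) (sym (List.map-++ Raise.inst I (concat run))) (either (∈.∈-++⁻ S′ x∈))
          where
          either : x ∈ S′ ⊎ x ∈ added → x ∈ map Raise.inst I ++ map Raise.inst (concat run)
          either (inj₁ x∈S′)    = ∈.∈-++⁺ʳ (map Raise.inst I) (IH.raised x∈S′)
          either (inj₂ x∈added) = ∈.∈-++⁺ˡ (added⊆ x∈added)

      ∑δ≤profit-phase2 : ∀ run → ValidRun N (zeroDuals N) run → Interference N run →
                         ∑ Raise.δ (concat run) ≤ profitSum N (phase2 N run)
      ∑δ≤profit-phase2 run valid interference = begin
        raised                                          ≡⟨ +-identityˡ raised ⟨
        0ℚ + raised                                     ≡⟨ cong (_+ raised) (∑-lhs-zeroDuals (phase2 N run)) ⟨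
        ∑ (lhs N (zeroDuals N)) (phase2 N run) + raised ≤⟨ Phase2Invariant.bound (phase2-invariant (zeroDuals N) run valid interference) ⟩
        profitSum N (phase2 N run)                      ∎
        where
        open ≤-Reasoning
        raised : ℚ
        raised = ∑ Raise.δ (concat run)

lemma6 : (N : Network) →
         (∀ t → IsTree N t) →
         (∀ d → ValidPath N d) →
         (∀ a → 0ℚ ≤ Network.profit N a) →
         (∀ a → 0ℚ < Network.height N a) →
         (∀ a → Network.height N a ≤ ½) →
         (run : List (List (Raise (Network.K N) (Network.E N)))) →
         ValidRun N (zeroDuals N) run →
         Interference N run →
         (λ′ : ℚ) → IsLambda N run λ′ →
         (Opt : List (Fin (Network.K N))) → IsOpt N Opt →
         λ′ * profitSum N Opt
           ≤ (1ℚ + ℕ→ℚ 2 * ℕ→ℚ (Δ N run) * ℕ→ℚ (Δ N run)) * profitSum N (phase2 N run)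
lemma6 N _ path-valid _ height-pos narrow run valid interference λ′ (_ , _ , λ-satisfied , _) Opt (opt-feasible , _) = begin
  λ′ * ∑ (p N) Opt                                 ≡⟨ ∑-*ˡ λ′ (p N) Opt ⟨
  ∑ (λ d → λ′ * p N d) Opt                         ≤⟨ ∑-mono-≤ Opt (λ {d} _ → λ-satisfied d) ⟩
  ∑ (lhs N (phase1 N run)) Opt                     ≤⟨ ∑-lhs-phase1≤ N path-valid height-nonNeg run Opt opt-feasible valid ⟩
  ratio (Δ N run) * ∑ Raise.δ (concat run)         ≤⟨ *-monoˡ-≤-0≤ (ratio-nonNeg (Δ N run))
                                                        (∑δ≤profit-phase2 N path-valid height-nonNeg narrow run valid interference) ⟩
  ratio (Δ N run) * profitSum N (phase2 N run)     ∎
  where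
  open ≤-Reasoning
  height-nonNeg : ∀ a → 0ℚ ≤ Network.height N a
  height-nonNeg a = <⇒≤ (height-pos a)
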